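{- Let $\mathsf{F}:\mathbf{BA}\to\mathbf{HA}$ be the left adjoint of the functor $\mathsf{Reg}:\mathbf{HA}\to\mathbf{BA}$. Then for every Boolean algebra $B$, the Heyting algebra $\mathsf{F}(B)$ is regular, i.e., it is generated as a Heyting algebra by its regular elements.
   Context: $\mathbf{HA}$ is the category of Heyting algebras and Heyting homomorphisms, $\mathbf{BA}$ that of Boolean algebras and Boolean homomorphisms. An element $a$ of a Heyting algebra $H$ is regular if $\neg\neg a=a$. $\mathsf{Reg}(H)=\{a\in H:\neg\neg a=a\}$ is a Boolean algebra (with meets from $H$, join $\neg\neg(a\vee b)$, complement $\neg$), and $\mathsf{Reg}$ is a functor $\mathbf{HA}\to\mathbf{BA}$ by restriction of homomorphisms; it has a left adjoint $\mathsf{F}$. A Heyting algebra is regular if it is generated as a Heyting algebra by its regular elements. -}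

module Defs where

open import Level using (Level; _⊔_; suc)
open import Data.Product using (Σ; _×_; _,_)
open import Relation.Binary.Lattice.Bundles using (HeytingAlgebra; BooleanAlgebra)

private
  variable
    a b₁ b₂ b₃ c₁ c₂ c₃ : Level

module _ (H : HeytingAlgebra c₁ c₂ c₃) where
  open HeytingAlgebra H

  neg : Carrier → Carrier
  neg x = x ⇨ ⊥

  IsRegularElt : Carrier → Set c₂
  IsRegularElt x = neg (neg x) ≈ x

  data Generated {p} (P : Carrier → Set p) : Carrier → Set (c₁ ⊔ c₂ ⊔ p) where
    gen  : ∀ {x} → P x → Generated P x
    g-≈  : ∀ {x y} → x ≈ y → Generated P x → Generated P y
    g-⊤  : Generated P ⊤
    g-⊥  : Generated P ⊥
    g-∧  : ∀ {x y} → Generated P x → Generated P y → Generated P (x ∧ y)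
    g-∨  : ∀ {x y} → Generated P x → Generated P y → Generated P (x ∨ y)
    g-⇨  : ∀ {x y} → Generated P x → Generated P y → Generated P (x ⇨ y)

  IsRegularHA : Set (c₁ ⊔ c₂)
  IsRegularHA = ∀ x → Generated IsRegularElt x

record HeytingHom (H : HeytingAlgebra c₁ c₂ c₃) (K : HeytingAlgebra b₁ b₂ b₃)
       : Set (c₁ ⊔ c₂ ⊔ b₁ ⊔ b₂) where
  private
    module H = HeytingAlgebra H
    module K = HeytingAlgebra K
  field
    fun    : H.Carrier → K.Carrier
    cong   : ∀ {x y} → x H.≈ y → fun x K.≈ fun y
    pres-∧ : ∀ x y → fun (x H.∧ y) K.≈ (fun x K.∧ fun y)
    pres-∨ : ∀ x y → fun (x H.∨ y) K.≈ (fun x K.∨ fun y)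
    pres-⇨ : ∀ x y → fun (x H.⇨ y) K.≈ (fun x K.⇨ fun y)
    pres-⊤ : fun H.⊤ K.≈ K.⊤
    pres-⊥ : fun H.⊥ K.≈ K.⊥

-- Boolean homomorphisms B → Reg(H), written out: a map into the regular
-- elements of H preserving ⊤, ⊥, ∧, complement (¬ in H), and the join of
-- Reg(H), which is ¬¬(x ∨ y).  Equality in Reg(H) is that of H.
record BoolHomToReg (B : BooleanAlgebra b₁ b₂ b₃) (H : HeytingAlgebra c₁ c₂ c₃)
       : Set (b₁ ⊔ b₂ ⊔ c₁ ⊔ c₂) where
  private
    module B = BooleanAlgebra B
    module H = HeytingAlgebra H
  field
    fun     : B.Carrier → H.Carrier
    regular : ∀ x → IsRegularElt H (fun x)
    cong    : ∀ {x y} → x B.≈ y → fun x H.≈ fun y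
    pres-∧  : ∀ x y → fun (x B.∧ y) H.≈ (fun x H.∧ fun y)
    pres-∨  : ∀ x y → fun (x B.∨ y) H.≈ neg H (neg H (fun x H.∨ fun y))
    pres-¬  : ∀ x → fun (B.¬ x) H.≈ neg H (fun x)
    pres-⊤  : fun B.⊤ H.≈ H.⊤
    pres-⊥  : fun B.⊥ H.≈ H.⊥

-- η : B → Reg(H) is a universal arrow from B to Reg (i.e. H together with η
-- is F(B) with its unit), relative to Heyting algebras at levels (a, a, a):
-- every g : B → Reg(K) factors as Reg(h) ∘ η for a unique Heyting hom h : H → K.
IsUnitOfFreeOver : (B : BooleanAlgebra b₁ b₂ b₃) (H : HeytingAlgebra a a a)
                   → BoolHomToReg B H → Set (suc a ⊔ b₁ ⊔ b₂)
IsUnitOfFreeOver {a = a} B H η =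
  (K : HeytingAlgebra a a a) (g : BoolHomToReg B K) →
  let open HeytingAlgebra K using () renaming (_≈_ to _≈K_) in
  Σ (HeytingHom H K) λ h →
    (∀ x → HeytingHom.fun h (BoolHomToReg.fun η x) ≈K BoolHomToReg.fun g x)
    × ((h′ : HeytingHom H K) →
       (∀ x → HeytingHom.fun h′ (BoolHomToReg.fun η x) ≈K BoolHomToReg.fun g x) →
       ∀ y → HeytingHom.fun h y ≈K HeytingHom.fun h′ y)

module Submission where

open import Defs
open import Level using (Level; _⊔_)
open import Relation.Binary.Lattice.Bundles using (HeytingAlgebra; BooleanAlgebra)
open import Data.Product using (Σ; _,_; proj₁; proj₂)
import Relation.Binary.Construct.On as On

-- F(B) maps into the subalgebra generated by its regular elements by the
-- universal property; composing with the inclusion gives an endomorphism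
-- that agrees with the identity on the unit, hence is the identity by
-- uniqueness.  So every element of F(B) lies in that subalgebra.

private
  variable
    a b₁ b₂ b₃ c₁ c₂ c₃ d₁ d₂ d₃ p : Level

idHom : (H : HeytingAlgebra c₁ c₂ c₃) → HeytingHom H H
idHom H = record
  { fun = λ x → x ; cong = λ e → e
  ; pres-∧ = λ _ _ → Eq.refl ; pres-∨ = λ _ _ → Eq.refl ; pres-⇨ = λ _ _ → Eq.refl
  ; pres-⊤ = Eq.refl ; pres-⊥ = Eq.refl }
  where open HeytingAlgebra H using (module Eq)

_∘Hom_ : {H : HeytingAlgebra c₁ c₂ c₃} {K : HeytingAlgebra b₁ b₂ b₃}
         {L : HeytingAlgebra d₁ d₂ d₃} →
         HeytingHom K L → HeytingHom H K → HeytingHom H L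
_∘Hom_ {L = L} g f = record
  { fun = λ x → g.fun (f.fun x)
  ; cong = λ e → g.cong (f.cong e)
  ; pres-∧ = λ x y → Eq.trans (g.cong (f.pres-∧ x y)) (g.pres-∧ _ _)
  ; pres-∨ = λ x y → Eq.trans (g.cong (f.pres-∨ x y)) (g.pres-∨ _ _)
  ; pres-⇨ = λ x y → Eq.trans (g.cong (f.pres-⇨ x y)) (g.pres-⇨ _ _)
  ; pres-⊤ = Eq.trans (g.cong f.pres-⊤) g.pres-⊤
  ; pres-⊥ = Eq.trans (g.cong f.pres-⊥) g.pres-⊥ }
  where
  open HeytingAlgebra L using (module Eq)
  module f = HeytingHom f
  module g = HeytingHom g

module _ (H : HeytingAlgebra c₁ c₂ c₃) (P : HeytingAlgebra.Carrier H → Set p) where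
  open HeytingAlgebra H

  generatedSubalgebra : HeytingAlgebra (c₁ ⊔ c₂ ⊔ p) c₂ c₃
  generatedSubalgebra = record
    { Carrier = Σ Carrier (Generated H P)
    ; _≈_ = λ x y → proj₁ x ≈ proj₁ y
    ; _≤_ = λ x y → proj₁ x ≤ proj₁ y
    ; _∨_ = λ (x , gx) (y , gy) → x ∨ y , g-∨ gx gy
    ; _∧_ = λ (x , gx) (y , gy) → x ∧ y , g-∧ gx gy
    ; _⇨_ = λ (x , gx) (y , gy) → x ⇨ y , g-⇨ gx gy
    ; ⊤ = ⊤ , g-⊤
    ; ⊥ = ⊥ , g-⊥
    ; isHeytingAlgebra = record
      { isBoundedLattice = record
        { isLattice = record
          { isPartialOrder = On.isPartialOrder proj₁ isPartialOrder
          ; supremum = λ (x , _) (y , _) →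
              let x≤ , y≤ , least = supremum x y in x≤ , y≤ , λ (z , _) → least z
          ; infimum = λ (x , _) (y , _) →
              let ≤x , ≤y , greatest = infimum x y in ≤x , ≤y , λ (z , _) → greatest z
          }
        ; maximum = λ (x , _) → maximum x
        ; minimum = λ (x , _) → minimum x
        }
      ; exponential = λ (w , _) (x , _) (y , _) → exponential w x y
      }
    }

  subalgebraInclusion : HeytingHom generatedSubalgebra H
  subalgebraInclusion = record
    { fun = proj₁ ; cong = λ e → e
    ; pres-∧ = λ _ _ → Eq.refl ; pres-∨ = λ _ _ → Eq.refl ; pres-⇨ = λ _ _ → Eq.refl
    ; pres-⊤ = Eq.refl ; pres-⊥ = Eq.refl }

regularSubalgebra : HeytingAlgebra c₁ c₂ c₃ → HeytingAlgebra (c₁ ⊔ c₂) c₂ c₃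
regularSubalgebra H = generatedSubalgebra H (IsRegularElt H)

-- Negation in the subalgebra is computed as in H, so the same proofs apply.
corestrictToRegular : {B : BooleanAlgebra b₁ b₂ b₃} {H : HeytingAlgebra c₁ c₂ c₃} →
                      BoolHomToReg B H → BoolHomToReg B (regularSubalgebra H)
corestrictToRegular η = record
  { fun = λ x → fun x , gen (regular x)
  ; regular = regular ; cong = cong
  ; pres-∧ = pres-∧ ; pres-∨ = pres-∨ ; pres-¬ = pres-¬
  ; pres-⊤ = pres-⊤ ; pres-⊥ = pres-⊥ }
  where open BoolHomToReg η

module _ {B : BooleanAlgebra b₁ b₂ b₃} {H K : HeytingAlgebra a a a} where
  open HeytingAlgebra K using (_≈_; module Eq)
  open HeytingHom using (fun)

  factorisationsAgree : (η : BoolHomToReg B H) → IsUnitOfFreeOver B H η →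
    (g : BoolHomToReg B K) →
    (f f′ : HeytingHom H K) →
    (∀ x → fun f (BoolHomToReg.fun η x) ≈ BoolHomToReg.fun g x) →
    (∀ x → fun f′ (BoolHomToReg.fun η x) ≈ BoolHomToReg.fun g x) →
    ∀ y → fun f y ≈ fun f′ y
  factorisationsAgree η univ g f f′ f-factors f′-factors y =
    Eq.trans (Eq.sym (proj₂ (proj₂ (univ K g)) f f-factors y))
             (proj₂ (proj₂ (univ K g)) f′ f′-factors y)

mainTheorem13 : {a b₁ b₂ b₃ : Level} (B : BooleanAlgebra b₁ b₂ b₃)
    (H : HeytingAlgebra a a a) (η : BoolHomToReg B H) →
    IsUnitOfFreeOver B H η → IsRegularHA H
mainTheorem13 {a} B H η univ y = g-≈ (retraction y) (proj₂ (HeytingHom.fun h y))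
  where
  open HeytingAlgebra H using (_≈_; module Eq)
  open BoolHomToReg using (fun)

  Reg : HeytingAlgebra a a a
  Reg = regularSubalgebra H

  h : HeytingHom H Reg
  h = proj₁ (univ Reg (corestrictToRegular η))

  h-factors : ∀ x → proj₁ (HeytingHom.fun h (fun η x)) ≈ fun η x
  h-factors = proj₁ (proj₂ (univ Reg (corestrictToRegular η)))

  retraction : ∀ z → proj₁ (HeytingHom.fun h z) ≈ z
  retraction = factorisationsAgree η univ η
    (subalgebraInclusion H (IsRegularElt H) ∘Hom h) (idHom H)
    h-factors (λ _ → Eq.refl)
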